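{- Let $G=(V,E)$ be a finite simple undirected graph, let $\alpha>0$, and let $(S,T)$ be any minimum $s$-$z$ cut in the network $H_\alpha$ (with $s\in S$, $z\in T$). Let $A_1=S\cap A$. Then the capacity of the cut $(S,T)$ equals $$\sum_{v\in A\setminus A_1} t_v+2t_2(A_1)+t_1(A_1)+3\alpha|A_1|.$$
   Context: For $v\in V$, $t_v$ is the number of triangles of $G$ containing $v$. For $X\subseteq V$ and $i\in\{1,2,3\}$, $t_i(X)$ denotes the number of triangles of $G$ having exactly $i$ of their three vertices in $X$. The network $H_\alpha$ is the capacitated directed graph with vertex set $\{s\}\cup A\cup B\cup\{z\}$, where $A=V$ and $B$ contains one node for each triangle of $G$ ($s$ is the source, $z$ the sink), and arcs: for each $v\in A$ and each triangle containing $v$, an arc from $v$ to that triangle's node of capacity $1$; for each triangle $\{u,v,w\}$, arcs from its node to each of $u,v,w$ of capacity $2$; for each $v\in A$, an arc $(s,v)$ of capacity $t_v$ and an arc $(v,z)$ of capacity $3\alpha$. The capacity of a cut $(S,T)$ is the total capacity of arcs from $S$ to $T$.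
   Formalization: The parameter α ranges over the positive rationals, so the capacities $3\alpha$ of the arcs into the sink are rational as well. -}

module Defs where

open import Data.Nat as ℕ using (ℕ; _<ᵇ_; _≡ᵇ_)
open import Data.Fin as Fin using (Fin; toℕ)
open import Data.Bool using (Bool; true; false; _∧_; not; if_then_else_)
open import Data.List using (List; []; _∷_; _++_; map; concatMap; filterᵇ; length; allFin; lookup; foldr; tabulate)
open import Data.Integer using (+_)
open import Data.Rational using (ℚ; 0ℚ; 1ℚ; _/_; _+_; _*_)
open import Data.Product using (_×_; _,_)
open import Relation.Binary.PropositionalEquality using (_≡_)
open import Relation.Nullary.Decidable using (⌊_⌋)

record SimpleGraph (n : ℕ) : Set where
  field
    adj    : Fin n → Fin n → Bool
    sym    : ∀ u v → adj u v ≡ adj v u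
    irrefl : ∀ v → adj v v ≡ false
open SimpleGraph public

Triple : ℕ → Set
Triple n = Fin n × Fin n × Fin n

allTriples : (n : ℕ) → List (Triple n)
allTriples n = concatMap (λ u → concatMap (λ v → map (λ w → u , v , w) (allFin n)) (allFin n)) (allFin n)

-- a triangle {u,v,w} is represented once, as the increasing triple u < v < w
isTriangle : ∀ {n} → SimpleGraph n → Triple n → Bool
isTriangle G (u , v , w) =
  (toℕ u <ᵇ toℕ v) ∧ (toℕ v <ᵇ toℕ w) ∧ adj G u v ∧ adj G v w ∧ adj G u w

triangles : ∀ {n} → SimpleGraph n → List (Triple n)
triangles {n} G = filterᵇ (isTriangle G) (allTriples n)

verts : ∀ {n} → Triple n → List (Fin n)
verts (u , v , w) = u ∷ v ∷ w ∷ []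

_==_ : ∀ {n} → Fin n → Fin n → Bool
x == y = ⌊ x Fin.≟ y ⌋

inTri : ∀ {n} → Fin n → Triple n → Bool
inTri x (u , v , w) = if x == u then true else if x == v then true else (x == w)

tri-count : ∀ {n} → SimpleGraph n → Fin n → ℕ
tri-count G v = length (filterᵇ (inTri v) (triangles G))

countIn : ∀ {n} → (Fin n → Bool) → Triple n → ℕ
countIn X (u , v , w) = b2n (X u) ℕ.+ b2n (X v) ℕ.+ b2n (X w)
  where
  b2n : Bool → ℕ
  b2n true = 1
  b2n false = 0

t[_] : ∀ {n} → ℕ → SimpleGraph n → (Fin n → Bool) → ℕ
t[ i ] G X = length (filterᵇ (λ τ → countIn X τ ≡ᵇ i) (triangles G))

card : ∀ {n} → (Fin n → Bool) → ℕ
card {n} X = length (filterᵇ X (allFin n))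

ℕ→ℚ : ℕ → ℚ
ℕ→ℚ k = + k / 1

sumℚ : List ℚ → ℚ
sumℚ = foldr _+_ 0ℚ

-- Nodes of the network H_α : source s, A = V, B = triangles (indexed by
-- position in the list 'triangles G'), sink z.
data Node (n m : ℕ) : Set where
  src : Node n m
  aN  : Fin n → Node n m
  bN  : Fin m → Node n m
  snk : Node n m

NodeH : ∀ {n} → SimpleGraph n → Set
NodeH {n} G = Node n (length (triangles G))

-- Arcs (tail , head , capacity) of H_α
arcs : ∀ {n} → (G : SimpleGraph n) → ℚ → List (NodeH G × NodeH G × ℚ)
arcs {n} G α =
     concatMap (λ v → (src , aN v , ℕ→ℚ (tri-count G v))
                    ∷ (aN v , snk , ℕ→ℚ 3 * α) ∷ []) (allFin n)
  ++ concatMap (λ k → concatMap (λ x → (aN x , bN k , 1ℚ)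
                                      ∷ (bN k , aN x , ℕ→ℚ 2) ∷ [])
                                 (verts (lookup (triangles G) k)))
               (allFin (length (triangles G)))

-- An s-z cut (S,T) is given by the characteristic function of S (T = complement).
IsCut : ∀ {n} (G : SimpleGraph n) → (NodeH G → Bool) → Set
IsCut G S = (S src ≡ true) × (S snk ≡ false)

capacity : ∀ {n} (G : SimpleGraph n) → ℚ → (NodeH G → Bool) → ℚ
capacity G α S = sumℚ (map cap (filterᵇ crosses (arcs G α)))
  where
  crosses : _ → Bool
  crosses (x , y , _) = S x ∧ not (S y)
  cap : _ → ℚ
  cap (_ , _ , c) = c

IsMinCut : ∀ {n} (G : SimpleGraph n) → ℚ → (NodeH G → Bool) → Set
IsMinCut G α S = IsCut G S × (∀ S′ → IsCut G S′ → capacity G α S Data.Rational.≤ capacity G α S′)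

-- Write X = S ∩ A for the vertices on the source side of a cut S.  The
-- capacity of any s-z cut splits into a vertex part and a triangle part:
-- each vertex v contributes t_v (arc s → v) if v ∉ X and 3α (arc v → z)
-- if v ∈ X, and each triangle node contributes the cut arcs of its gadget,
-- 1 per vertex in X when the node lies in T and 2 per vertex outside X when
-- it lies in S.  The cheapest placement of a triangle node with i vertices
-- in X costs 0, 1, 2, 0 for i = 0, 1, 2, 3, and it is attained by putting
-- the node in S exactly when all three of its vertices are in X.
--
-- Hence moving every triangle node of S to its cheapest side gives a cut S⋆
-- with capacity S⋆ ≤ capacity S; minimality of S forces equality, and the
-- capacity of S⋆ is computed explicitly: the vertex part is
-- Σ_{v ∉ X} t_v + 3α|X| and the triangle part is 2 t₂(X) + t₁(X).
module Submission where

open import Defs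
open import Data.Nat using (ℕ)
open import Data.Fin using (Fin)
open import Data.Bool using (Bool; not)
open import Data.List using (map; filterᵇ; allFin)
open import Data.Rational using (ℚ; 0ℚ; _<_; _+_; _*_)
open import Relation.Binary.PropositionalEquality using (_≡_)

open import Data.Nat as ℕ using (suc; _≡ᵇ_)
import Data.Nat.Properties as ℕ
open import Data.Nat.ListAction using (sum)
open import Data.Nat.Coprimality using (1-coprimeTo) renaming (sym to Coprime-sym)
import Data.Integer as ℤ
import Data.Integer.Properties as ℤ
open import Data.Rational using (1ℚ; mkℚ; _/_; _≤_; *≤*)
open import Data.Rational.Properties
  using (normalize-coprime; ≤-antisym; +-identityˡ; +-identityʳ; +-assoc; *-zeroʳ;
         *-identityʳ; *-distribˡ-+; +-monoʳ-≤; +-0-commutativeMonoid)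
open import Algebra.Bundles using (CommutativeMonoid)
open import Algebra.Properties.CommutativeSemigroup
  (CommutativeMonoid.commutativeSemigroup +-0-commutativeMonoid) using (interchange; xy∙z≈xz∙y)
open import Data.Bool using (true; false; _∧_; if_then_else_)
open import Data.Unit using (tt)
open import Data.List using (List; []; _∷_; _++_; concatMap; length; lookup)
open import Data.List.Properties using (map-cong; map-∘; map-tabulate; tabulate-lookup)
open import Data.Product using (_×_; _,_)
open import Relation.Binary.PropositionalEquality
  using (refl; trans; cong; cong₂; subst₂; module ≡-Reasoning) renaming (sym to ≡-sym)

ℕ→ℚ-mkℚ : ∀ k → ℕ→ℚ k ≡ mkℚ (ℤ.+ k) 0 (Coprime-sym (1-coprimeTo k))
ℕ→ℚ-mkℚ k = normalize-coprime (Coprime-sym (1-coprimeTo k))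

ℕ→ℚ-+ : ∀ a b → ℕ→ℚ (a ℕ.+ b) ≡ ℕ→ℚ a + ℕ→ℚ b
ℕ→ℚ-+ a b = ≡-sym (begin
  ℕ→ℚ a + ℕ→ℚ b
    ≡⟨ cong₂ _+_ (ℕ→ℚ-mkℚ a) (ℕ→ℚ-mkℚ b) ⟩
  (ℤ.+ a ℤ.* ℤ.+ 1 ℤ.+ ℤ.+ b ℤ.* ℤ.+ 1) / 1
    ≡⟨ cong (_/ 1) (cong₂ ℤ._+_ (ℤ.*-identityʳ (ℤ.+ a)) (ℤ.*-identityʳ (ℤ.+ b))) ⟩
  (ℤ.+ a ℤ.+ ℤ.+ b) / 1
    ≡⟨ cong (_/ 1) (≡-sym (ℤ.pos-+ a b)) ⟩
  ℕ→ℚ (a ℕ.+ b) ∎)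
  where open ≡-Reasoning

ℕ→ℚ-* : ∀ a b → ℕ→ℚ (a ℕ.* b) ≡ ℕ→ℚ a * ℕ→ℚ b
ℕ→ℚ-* a b = ≡-sym (trans (cong₂ _*_ (ℕ→ℚ-mkℚ a) (ℕ→ℚ-mkℚ b))
                       (cong (_/ 1) (≡-sym (ℤ.pos-* a b))))

ℕ→ℚ-mono : ∀ {a b} → a ℕ.≤ b → ℕ→ℚ a ≤ ℕ→ℚ b
ℕ→ℚ-mono {a} {b} a≤b rewrite ℕ→ℚ-mkℚ a | ℕ→ℚ-mkℚ b =
  *≤* (subst₂ ℤ._≤_ (≡-sym (ℤ.*-identityʳ (ℤ.+ a))) (≡-sym (ℤ.*-identityʳ (ℤ.+ b))) (ℤ.+≤+ a≤b))

Σℚ : {A : Set} → (A → ℚ) → List A → ℚ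
Σℚ f xs = sumℚ (map f xs)

module _ {A : Set} where

  Σℚ-cong : ∀ {f g : A → ℚ} → (∀ x → f x ≡ g x) → ∀ xs → Σℚ f xs ≡ Σℚ g xs
  Σℚ-cong f≗g xs = cong sumℚ (map-cong f≗g xs)

  Σℚ-++ : ∀ (f : A → ℚ) xs ys → Σℚ f (xs ++ ys) ≡ Σℚ f xs + Σℚ f ys
  Σℚ-++ f []       ys = ≡-sym (+-identityˡ (Σℚ f ys))
  Σℚ-++ f (x ∷ xs) ys = trans (cong (f x +_) (Σℚ-++ f xs ys)) (≡-sym (+-assoc (f x) _ _))

  Σℚ-concatMap : ∀ {B : Set} (f : A → ℚ) (g : B → List A) xs →
                 Σℚ f (concatMap g xs) ≡ Σℚ (λ x → Σℚ f (g x)) xs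
  Σℚ-concatMap f g []       = refl
  Σℚ-concatMap f g (x ∷ xs) = trans (Σℚ-++ f (g x) (concatMap g xs))
                                    (cong (Σℚ f (g x) +_) (Σℚ-concatMap f g xs))

  Σℚ-+ : ∀ (f g : A → ℚ) xs → Σℚ (λ x → f x + g x) xs ≡ Σℚ f xs + Σℚ g xs
  Σℚ-+ f g []       = ≡-sym (+-identityˡ 0ℚ)
  Σℚ-+ f g (x ∷ xs) = begin
    (f x + g x) + Σℚ (λ x → f x + g x) xs   ≡⟨ cong ((f x + g x) +_) (Σℚ-+ f g xs) ⟩
    (f x + g x) + (Σℚ f xs + Σℚ g xs)       ≡⟨ interchange (f x) (g x) (Σℚ f xs) (Σℚ g xs) ⟩
    (f x + Σℚ f xs) + (g x + Σℚ g xs)       ∎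
    where open ≡-Reasoning

  Σℚ-const : ∀ (r : ℚ) (xs : List A) → Σℚ (λ _ → r) xs ≡ r * ℕ→ℚ (length xs)
  Σℚ-const r []       = ≡-sym (*-zeroʳ r)
  Σℚ-const r (x ∷ xs) = begin
    r + Σℚ (λ _ → r) xs           ≡⟨ cong (r +_) (Σℚ-const r xs) ⟩
    r + r * ℕ→ℚ (length xs)       ≡⟨ cong (_+ r * ℕ→ℚ (length xs)) (≡-sym (*-identityʳ r)) ⟩
    r * ℕ→ℚ 1 + r * ℕ→ℚ (length xs) ≡⟨ ≡-sym (*-distribˡ-+ r _ _) ⟩
    r * (ℕ→ℚ 1 + ℕ→ℚ (length xs)) ≡⟨ cong (r *_) (≡-sym (ℕ→ℚ-+ 1 (length xs))) ⟩
    r * ℕ→ℚ (length (x ∷ xs))     ∎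
    where open ≡-Reasoning

  Σℚ-filterᵇ : ∀ (p : A → Bool) (f : A → ℚ) xs →
               Σℚ f (filterᵇ p xs) ≡ Σℚ (λ x → if p x then f x else 0ℚ) xs
  Σℚ-filterᵇ p f []       = refl
  Σℚ-filterᵇ p f (x ∷ xs) with p x
  ... | true  = cong (f x +_) (Σℚ-filterᵇ p f xs)
  ... | false = ≡-sym (trans (+-identityˡ _) (≡-sym (Σℚ-filterᵇ p f xs)))

  Σℚ-select : ∀ (X : A → Bool) (r : ℚ) (t : A → ℚ) xs →
              Σℚ (λ x → if X x then r else t x) xs
                ≡ Σℚ t (filterᵇ (λ x → not (X x)) xs) + r * ℕ→ℚ (length (filterᵇ X xs))
  Σℚ-select X r t xs = begin
    Σℚ (λ x → if X x then r else t x) xs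
      ≡⟨ Σℚ-cong split xs ⟩
    Σℚ (λ x → outside x + inside x) xs
      ≡⟨ Σℚ-+ outside inside xs ⟩
    Σℚ outside xs + Σℚ inside xs
      ≡⟨ ≡-sym (cong₂ _+_ (Σℚ-filterᵇ (λ x → not (X x)) t xs) (Σℚ-filterᵇ X (λ _ → r) xs)) ⟩
    Σℚ t (filterᵇ (λ x → not (X x)) xs) + Σℚ (λ _ → r) (filterᵇ X xs)
      ≡⟨ cong (Σℚ t (filterᵇ (λ x → not (X x)) xs) +_) (Σℚ-const r (filterᵇ X xs)) ⟩
    Σℚ t (filterᵇ (λ x → not (X x)) xs) + r * ℕ→ℚ (length (filterᵇ X xs)) ∎
    where
    open ≡-Reasoning
    outside inside : A → ℚ
    outside x = if not (X x) then t x else 0ℚ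
    inside x = if X x then r else 0ℚ
    split : ∀ x → (if X x then r else t x) ≡ outside x + inside x
    split x with X x
    ... | true  = ≡-sym (+-identityˡ r)
    ... | false = ≡-sym (+-identityʳ (t x))

  Σℚ-ℕ→ℚ : ∀ (f : A → ℕ) xs → Σℚ (λ x → ℕ→ℚ (f x)) xs ≡ ℕ→ℚ (sum (map f xs))
  Σℚ-ℕ→ℚ f []       = refl
  Σℚ-ℕ→ℚ f (x ∷ xs) = trans (cong (ℕ→ℚ (f x) +_) (Σℚ-ℕ→ℚ f xs)) (≡-sym (ℕ→ℚ-+ (f x) _))

  sum-mono : ∀ (f g : A → ℕ) → (∀ x → f x ℕ.≤ g x) → ∀ xs → sum (map f xs) ℕ.≤ sum (map g xs)
  sum-mono f g f≤g []       = ℕ.z≤n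
  sum-mono f g f≤g (x ∷ xs) = ℕ.+-mono-≤ (f≤g x) (sum-mono f g f≤g xs)

  map-lookup : ∀ {B : Set} (h : A → B) (L : List A) →
               map (λ k → h (lookup L k)) (allFin (length L)) ≡ map h L
  map-lookup h L = trans (map-∘ (allFin (length L)))
    (cong (map h) (trans (map-tabulate (λ i → i) (lookup L)) (tabulate-lookup L)))

-- Cut capacity between a triangle node on side b and one of its vertices on side a
-- (true = source side): the arc triangle → vertex has capacity 2, vertex → triangle 1.
linkCost : Bool → Bool → ℕ
linkCost true  false = 2
linkCost false true  = 1
linkCost _     _     = 0

triangleCost : ∀ {n} → (Fin n → Bool) → Bool → Triple n → ℕ
triangleCost X b τ = sum (map (λ x → linkCost b (X x)) (verts τ))

optimalCost : ℕ → ℕ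
optimalCost 1 = 1
optimalCost 2 = 2
optimalCost _ = 0

-- the optimal side of a triangle node: the source side iff all three vertices are in X
allIn : ∀ {n} → (Fin n → Bool) → Triple n → Bool
allIn X (u , v , w) = X u ∧ X v ∧ X w

optimalCost-≤ : ∀ {n} (X : Fin n → Bool) b τ → optimalCost (countIn X τ) ℕ.≤ triangleCost X b τ
optimalCost-≤ X b (u , v , w) with X u | X v | X w | b
... | true  | true  | true  | _     = ℕ.z≤n
... | true  | true  | false | true  = ℕ.≤-refl
... | true  | true  | false | false = ℕ.≤-refl
... | true  | false | true  | true  = ℕ.≤-refl
... | true  | false | true  | false = ℕ.≤-refl
... | false | true  | true  | true  = ℕ.≤-refl
... | false | true  | true  | false = ℕ.≤-refl
... | true  | false | false | true  = ℕ.≤ᵇ⇒≤ 1 4 tt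
... | true  | false | false | false = ℕ.≤-refl
... | false | true  | false | true  = ℕ.≤ᵇ⇒≤ 1 4 tt
... | false | true  | false | false = ℕ.≤-refl
... | false | false | true  | true  = ℕ.≤ᵇ⇒≤ 1 4 tt
... | false | false | true  | false = ℕ.≤-refl
... | false | false | false | _     = ℕ.z≤n

optimalCost-allIn : ∀ {n} (X : Fin n → Bool) τ → triangleCost X (allIn X τ) τ ≡ optimalCost (countIn X τ)
optimalCost-allIn X (u , v , w) with X u | X v | X w
... | true  | true  | true  = refl
... | true  | true  | false = refl
... | true  | false | true  = refl
... | true  | false | false = refl
... | false | true  | true  = refl
... | false | true  | false = refl
... | false | false | true  = refl
... | false | false | false = refl

sum-optimalCost : ∀ {n} (X : Fin n → Bool) (L : List (Triple n)) →
  sum (map (λ τ → optimalCost (countIn X τ)) L)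
    ≡ 2 ℕ.* length (filterᵇ (λ τ → countIn X τ ≡ᵇ 2) L) ℕ.+ length (filterᵇ (λ τ → countIn X τ ≡ᵇ 1) L)
sum-optimalCost X [] = refl
sum-optimalCost X (τ ∷ L) with countIn X τ
... | 0                 = sum-optimalCost X L
... | 1                 = trans (cong suc (sum-optimalCost X L)) (≡-sym (ℕ.+-suc (2 ℕ.* t₂) t₁))
  where
  t₂ = length (filterᵇ (λ τ → countIn X τ ≡ᵇ 2) L)
  t₁ = length (filterᵇ (λ τ → countIn X τ ≡ᵇ 1) L)
... | 2                 = trans (cong (2 ℕ.+_) (sum-optimalCost X L))
  (≡-sym (trans (cong (ℕ._+ t₁) (ℕ.*-suc 2 t₂)) (ℕ.+-assoc 2 (2 ℕ.* t₂) t₁)))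
  where
  t₂ = length (filterᵇ (λ τ → countIn X τ ≡ᵇ 2) L)
  t₁ = length (filterᵇ (λ τ → countIn X τ ≡ᵇ 1) L)
... | suc (suc (suc _)) = sum-optimalCost X L

module _ {n} (G : SimpleGraph n) where

  Arc : Set
  Arc = NodeH G × NodeH G × ℚ

  sourceVertices : (NodeH G → Bool) → Fin n → Bool
  sourceVertices S v = S (aN v)

  arcCut : (NodeH G → Bool) → Arc → ℚ
  arcCut S (x , y , c) = if S x ∧ not (S y) then c else 0ℚ

  linkArcs : Fin (length (triangles G)) → Fin n → List Arc
  linkArcs k x = (aN x , bN k , 1ℚ) ∷ (bN k , aN x , ℕ→ℚ 2) ∷ []

  triangleArcs : Fin (length (triangles G)) → List Arc
  triangleArcs k = concatMap (linkArcs k) (verts (lookup (triangles G) k))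

  trianglePart : (NodeH G → Bool) → ℕ
  trianglePart S = sum (map (λ k → triangleCost (sourceVertices S) (S (bN k)) (lookup (triangles G) k))
                            (allFin (length (triangles G))))

  triangleArcs-cut : ∀ S k → Σℚ (arcCut S) (triangleArcs k)
                              ≡ ℕ→ℚ (triangleCost (sourceVertices S) (S (bN k)) (lookup (triangles G) k))
  triangleArcs-cut S k = trans (Σℚ-concatMap (arcCut S) (linkArcs k) (verts (lookup (triangles G) k)))
    (trans (Σℚ-cong link (verts (lookup (triangles G) k)))
           (Σℚ-ℕ→ℚ (λ x → linkCost (S (bN k)) (S (aN x))) (verts (lookup (triangles G) k))))
    where
    link : ∀ x → Σℚ (arcCut S) (linkArcs k x) ≡ ℕ→ℚ (linkCost (S (bN k)) (S (aN x)))
    link x with S (bN k) | S (aN x)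
    ... | true  | true  = refl
    ... | true  | false = refl
    ... | false | true  = refl
    ... | false | false = refl

  improve : (NodeH G → Bool) → NodeH G → Bool
  improve S (bN k) = allIn (sourceVertices S) (lookup (triangles G) k)
  improve S x      = S x

  improve-≤ : ∀ S → trianglePart (improve S) ℕ.≤ trianglePart S
  improve-≤ S = sum-mono _ _ optimal-≤ (allFin (length (triangles G)))
    where
    optimal-≤ : ∀ k → triangleCost (sourceVertices S) (improve S (bN k)) (lookup (triangles G) k)
                      ℕ.≤ triangleCost (sourceVertices S) (S (bN k)) (lookup (triangles G) k)
    optimal-≤ k = subst₂ ℕ._≤_ (≡-sym (optimalCost-allIn (sourceVertices S) (lookup (triangles G) k))) refl
                         (optimalCost-≤ (sourceVertices S) (S (bN k)) (lookup (triangles G) k))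

  improve-trianglePart : ∀ S →
    trianglePart (improve S) ≡ 2 ℕ.* t[ 2 ] G (sourceVertices S) ℕ.+ t[ 1 ] G (sourceVertices S)
  improve-trianglePart S = begin
    sum (map (λ k → cost (lookup (triangles G) k)) (allFin (length (triangles G))))
      ≡⟨ cong sum (map-lookup cost (triangles G)) ⟩
    sum (map cost (triangles G))
      ≡⟨ cong sum (map-cong (optimalCost-allIn X) (triangles G)) ⟩
    sum (map (λ τ → optimalCost (countIn X τ)) (triangles G))
      ≡⟨ sum-optimalCost X (triangles G) ⟩
    2 ℕ.* t[ 2 ] G X ℕ.+ t[ 1 ] G X ∎
    where
    open ≡-Reasoning
    X : Fin n → Bool
    X = sourceVertices S
    cost : Triple n → ℕ
    cost τ = triangleCost X (allIn X τ) τ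

  module _ (α : ℚ) where

    vertexArcs : Fin n → List Arc
    vertexArcs v = (src , aN v , ℕ→ℚ (tri-count G v)) ∷ (aN v , snk , ℕ→ℚ 3 * α) ∷ []

    vertexCost : (NodeH G → Bool) → Fin n → ℚ
    vertexCost S v = if S (aN v) then ℕ→ℚ 3 * α else ℕ→ℚ (tri-count G v)

    -- with s ∈ S and z ∉ S exactly one of the two arcs at v is cut
    vertexArcs-cut : ∀ S → IsCut G S → ∀ v → Σℚ (arcCut S) (vertexArcs v) ≡ vertexCost S v
    vertexArcs-cut S (s∈S , z∉S) v =
      trans (cong₂ (λ p q → (if p ∧ not a then t else 0ℚ) + ((if a ∧ not q then c else 0ℚ) + 0ℚ))
                   s∈S z∉S)
            (one-cut a)
      where
      a = S (aN v)
      t = ℕ→ℚ (tri-count G v)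
      c = ℕ→ℚ 3 * α
      one-cut : ∀ a → (if true ∧ not a then t else 0ℚ) + ((if a ∧ not false then c else 0ℚ) + 0ℚ)
                      ≡ (if a then c else t)
      one-cut true  = trans (+-identityˡ (c + 0ℚ)) (+-identityʳ c)
      one-cut false = trans (cong (t +_) (+-identityˡ 0ℚ)) (+-identityʳ t)

    capacity-decomposition : ∀ S → IsCut G S →
      capacity G α S ≡ Σℚ (vertexCost S) (allFin n) + ℕ→ℚ (trianglePart S)
    capacity-decomposition S cut = begin
      capacity G α S
        ≡⟨ Σℚ-filterᵇ _ _ (arcs G α) ⟩
      Σℚ (arcCut S) (concatMap vertexArcs (allFin n) ++ concatMap triangleArcs (allFin m))
        ≡⟨ Σℚ-++ (arcCut S) (concatMap vertexArcs (allFin n)) (concatMap triangleArcs (allFin m)) ⟩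
      Σℚ (arcCut S) (concatMap vertexArcs (allFin n)) + Σℚ (arcCut S) (concatMap triangleArcs (allFin m))
        ≡⟨ cong₂ _+_ (Σℚ-concatMap (arcCut S) vertexArcs (allFin n))
                     (Σℚ-concatMap (arcCut S) triangleArcs (allFin m)) ⟩
      Σℚ (λ v → Σℚ (arcCut S) (vertexArcs v)) (allFin n)
        + Σℚ (λ k → Σℚ (arcCut S) (triangleArcs k)) (allFin m)
        ≡⟨ cong₂ _+_ (Σℚ-cong (vertexArcs-cut S cut) (allFin n))
                     (trans (Σℚ-cong (triangleArcs-cut S) (allFin m))
                            (Σℚ-ℕ→ℚ (λ k → triangleCost (sourceVertices S) (S (bN k)) (lookup (triangles G) k))
                                    (allFin m))) ⟩
      Σℚ (vertexCost S) (allFin n) + ℕ→ℚ (trianglePart S) ∎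
      where
      open ≡-Reasoning
      m = length (triangles G)

    improve-capacity-≤ : ∀ S → IsCut G S → capacity G α (improve S) ≤ capacity G α S
    improve-capacity-≤ S cut =
      subst₂ _≤_ (≡-sym (capacity-decomposition (improve S) cut)) (≡-sym (capacity-decomposition S cut))
        (+-monoʳ-≤ (Σℚ (vertexCost S) (allFin n)) (ℕ→ℚ-mono (improve-≤ S)))

lemma2 : ∀ {n} (G : SimpleGraph n) (α : ℚ) → 0ℚ < α →
    (S : NodeH G → Bool) → IsMinCut G α S →
    capacity G α S ≡
      sumℚ (map (λ v → ℕ→ℚ (tri-count G v)) (filterᵇ (λ v → not (S (aN v))) (allFin n)))
      + ℕ→ℚ 2 * ℕ→ℚ (t[ 2 ] G (λ v → S (aN v)))
      + ℕ→ℚ (t[ 1 ] G (λ v → S (aN v)))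
      + ℕ→ℚ 3 * α * ℕ→ℚ (card (λ v → S (aN v)))
lemma2 {n} G α _ S (cut , minimal) = begin
  capacity G α S
    ≡⟨ ≤-antisym (minimal (improve G S) cut) (improve-capacity-≤ G α S cut) ⟩
  capacity G α (improve G S)
    ≡⟨ capacity-decomposition G α (improve G S) cut ⟩
  Σℚ (vertexCost G α S) (allFin n) + ℕ→ℚ (trianglePart G (improve G S))
    ≡⟨ cong₂ _+_ (Σℚ-select X r t (allFin n)) (cong ℕ→ℚ (improve-trianglePart G S)) ⟩
  (outside + inside) + ℕ→ℚ (2 ℕ.* t₂ ℕ.+ t₁)
    ≡⟨ cong ((outside + inside) +_) (trans (ℕ→ℚ-+ (2 ℕ.* t₂) t₁) (cong (_+ ℕ→ℚ t₁) (ℕ→ℚ-* 2 t₂))) ⟩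
  (outside + inside) + (ℕ→ℚ 2 * ℕ→ℚ t₂ + ℕ→ℚ t₁)
    ≡⟨ ≡-sym (xy∙z≈xz∙y outside (ℕ→ℚ 2 * ℕ→ℚ t₂ + ℕ→ℚ t₁) inside) ⟩
  (outside + (ℕ→ℚ 2 * ℕ→ℚ t₂ + ℕ→ℚ t₁)) + inside
    ≡⟨ cong (_+ inside) (≡-sym (+-assoc outside (ℕ→ℚ 2 * ℕ→ℚ t₂) (ℕ→ℚ t₁))) ⟩
  outside + ℕ→ℚ 2 * ℕ→ℚ t₂ + ℕ→ℚ t₁ + inside ∎
  where
  open ≡-Reasoning
  X : Fin n → Bool
  X = sourceVertices G S
  t : Fin n → ℚ
  t v = ℕ→ℚ (tri-count G v)
  r : ℚ
  r = ℕ→ℚ 3 * α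
  t₁ t₂ : ℕ
  t₁ = t[ 1 ] G X
  t₂ = t[ 2 ] G X
  outside inside : ℚ
  outside = Σℚ t (filterᵇ (λ v → not (X v)) (allFin n))
  inside = r * ℕ→ℚ (card X)
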